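{- Let $f:\mathcal M^2\to\{0,1\}$ be a function defined in the ground model $\mathcal M$ such that the binary relation $f(x,y)=1$ is well founded in $\mathcal M$. Then for every formula $F[x]$ of ZF$_\varepsilon$ with parameters in $\mathcal M$: $$Y\Vdash\forall y\big(\forall x(f(x,y)=1\hookrightarrow F[x])\to F[y]\big)\to\forall y\,F[y],$$ where $Y=AA$ and $A=\lambda a\lambda f(f)(a)af$ (equivalently $A=(W)(B)(BW)(C)B$).
   Context: A realizability algebra consists of sets $\Lambda$ (terms), $\Pi$ (stacks), $\Lambda\star\Pi$ (processes), maps $(\xi,\eta)\mapsto(\xi)\eta$ (application, $\Lambda^2\to\Lambda$; $(\xi)\eta_1\dots\eta_n$ means left-nested application), $(\xi,\pi)\mapsto\xi\cdot\pi$ ($\Lambda\times\Pi\to\Pi$), $(\xi,\pi)\mapsto\xi\star\pi$ ($\Lambda\times\Pi\to\Lambda\star\Pi$), $\pi\mapsto k_\pi$ ($\Pi\to\Lambda$), and distinguished terms $B,C,I,K,W,\mathrm{cc}$. Execution $\succ$ is the least reflexive transitive relation on $\Lambda\star\Pi$ with $(\xi)\eta\star\pi\succ\xi\star\eta\cdot\pi$, $I\star\xi\cdot\pi\succ\xi\star\pi$, $K\star\xi\cdot\eta\cdot\pi\succ\xi\star\pi$, $W\star\xi\cdot\eta\cdot\pi\succ\xi\star\eta\cdot\eta\cdot\pi$, $C\star\xi\cdot\eta\cdot\zeta\cdot\pi\succ\xi\star\zeta\cdot\eta\cdot\pi$, $B\star\xi\cdot\eta\cdot\zeta\cdot\pi\succ\xi\star(\eta)\zeta\cdot\pi$,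 $\mathrm{cc}\star\xi\cdot\pi\succ\xi\star k_\pi\cdot\pi$, $k_\pi\star\xi\cdot\varpi\succ\xi\star\pi$. A set $\perp\!\!\!\perp\subseteq\Lambda\star\Pi$ is given, closed under anti-execution ($\xi\star\pi\succ\xi'\star\pi'\in\perp\!\!\!\perp\Rightarrow\xi\star\pi\in\perp\!\!\!\perp$), and a set QP of proof-like terms containing the six instructions and closed under application; the algebra is coherent if for each $\theta\in$ QP some $\pi$ has $\theta\star\pi\notin\perp\!\!\!\perp$. $\lambda$-terms are translated into combinatory terms (built from instructions by application) by a fixed bracket abstraction such that $\lambda x_1\dots\lambda x_n t\star\xi_1\cdot\ldots\cdot\xi_n\cdot\pi\succ t[\vec\xi/\vec x]\star\pi$. The ground model $\mathcal M$ satisfies ZF + $V=L$ and a coherent realizability algebra $\mathcal A$ is given in $\mathcal M$. Formulas of ZF$_\varepsilon$ are built from atomic $\top,\bot,t\not\varepsilon u,t\notin u,t\subset u$ with only $\to,\forall$; $\neg A$ is $A\to\bot$. Every functional definable in $\mathcal M$ is a function symbol with its $\mathcal M$-interpretation. The realizability model $\mathcal N_{\mathcal A}$ has the individuals of $\mathcal M$; closed formulas with parameters get falsity values $\|F\|\subseteq\Pi$: $\|\top\|=\emptyset$, $\|\bot\|=\Pi$, $\|a\not\varepsilon b\|=\{\pi:(a,\pi)\in b\}$, $\|a\subset b\|=\bigcup_c\{\xi\cdot\pi:(c,\pi)\in a,\xi\Vdash c\notin b\}$, $\|a\notin b\|=\bigcup_c\{\xi\cdot\xi'\cdot\pi:(c,\pi)\in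 b,\xi\Vdash a\subset c,\xi'\Vdash c\subset a\}$ (induction on ranks), $\|A\to B\|=\{\xi\cdot\pi:\xi\Vdash A,\pi\in\|B\|\}$, $\|\forall xA\|=\bigcup_a\|A[a/x]\|$; $\xi\Vdash F$ means $\xi\star\pi\in\perp\!\!\!\perp$ for all $\pi\in\|F\|$. For terms $t,u$ (built from variables, parameters and function symbols of $\mathcal M$): $\|t=u\hookrightarrow F\|=\|F\|$ if $t=u$ holds in $\mathcal M$, and $=\emptyset$ otherwise. -}

module Defs where

open import Data.Nat using (ℕ; suc)
open import Data.Fin using (Fin; zero; suc)
open import Data.Product using (Σ; _×_; _,_)
open import Data.Empty using (⊥)
open import Data.Unit using (⊤)
open import Relation.Nullary using (¬_)
open import Relation.Binary.PropositionalEquality using (_≡_)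
open import Induction.WellFounded using (WellFounded; Acc; acc)

record RAStructure : Set₁ where
  infixl 9 _＠_
  infixr 8 _∙_
  infix 7 _⋆_
  field
    Λ Π Proc : Set            -- terms, stacks, processes (Λ ⋆ Π)
    _＠_ : Λ → Λ → Λ
    _∙_ : Λ → Π → Π
    _⋆_ : Λ → Π → Proc
    k : Π → Λ
    B C I K W cc : Λ

module Execution (S : RAStructure) where
  open RAStructure S
  infix 4 _≻_
  data _≻_ : Proc → Proc → Set where
    ≻-refl  : ∀ {p} → p ≻ p
    ≻-trans : ∀ {p q r} → p ≻ q → q ≻ r → p ≻ r
    ≻-app   : ∀ {ξ η π} → (ξ ＠ η) ⋆ π ≻ ξ ⋆ η ∙ π
    ≻-I     : ∀ {ξ π} → I ⋆ ξ ∙ π ≻ ξ ⋆ π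
    ≻-K     : ∀ {ξ η π} → K ⋆ ξ ∙ η ∙ π ≻ ξ ⋆ π
    ≻-W     : ∀ {ξ η π} → W ⋆ ξ ∙ η ∙ π ≻ ξ ⋆ η ∙ η ∙ π
    ≻-C     : ∀ {ξ η ζ π} → C ⋆ ξ ∙ η ∙ ζ ∙ π ≻ ξ ⋆ ζ ∙ η ∙ π
    ≻-B     : ∀ {ξ η ζ π} → B ⋆ ξ ∙ η ∙ ζ ∙ π ≻ ξ ⋆ (η ＠ ζ) ∙ π
    ≻-cc    : ∀ {ξ π} → cc ⋆ ξ ∙ π ≻ ξ ⋆ k π ∙ π
    ≻-k     : ∀ {π ξ ϖ} → k π ⋆ ξ ∙ ϖ ≻ ξ ⋆ π

record RealizabilityAlgebra : Set₁ where
  field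
    structure : RAStructure
  open RAStructure structure public
  open Execution structure public
  field
    ⊥⊥ : Proc → Set
    ⊥⊥-antiexec : ∀ {p q} → p ≻ q → ⊥⊥ q → ⊥⊥ p
    QP : Λ → Set                                    -- proof-like terms
    QP-B : QP B
    QP-C : QP C
    QP-I : QP I
    QP-K : QP K
    QP-W : QP W
    QP-cc : QP cc
    QP-app : ∀ {ξ η} → QP ξ → QP η → QP (ξ ＠ η)
    coherent : ∀ θ → QP θ → Σ Π λ π → ¬ ⊥⊥ (θ ⋆ π)

-- The ground model (abstracted: a type of individuals together with the
-- relation "(c , π) ∈ b", which is well founded as it is in any model of ZF).

record GroundModel (𝒜 : RealizabilityAlgebra) : Set₁ where
  open RealizabilityAlgebra 𝒜
  field
    U : Set
    In : U → Π → U → Set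
  _≺_ : U → U → Set
  c ≺ b = Σ Π λ π → In c π b
  field
    ≺-wf : WellFounded _≺_

-- Syntax of ZF_ε with parameters in U; variables are de Bruijn indices.
-- Function symbols: arbitrary functionals of the ground model.

data Term (U : Set) (n : ℕ) : Set where
  var : Fin n → Term U n
  par : U → Term U n
  fun : (m : ℕ) → ((Fin m → U) → U) → (Fin m → Term U n) → Term U n

infix 6 _∉ε_ _∉'_ _⊂'_
infixr 5 _⇒_
data Formula (U : Set) (n : ℕ) : Set where
  ⊤' ⊥' : Formula U n
  _∉ε_ _∉'_ _⊂'_ : Term U n → Term U n → Formula U n
  _⇒_ : Formula U n → Formula U n → Formula U n
  ∀' : Formula U (suc n) → Formula U n

extend : ∀ {U : Set} {n} → (Fin n → U) → U → Fin (suc n) → U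
extend ρ a zero = a
extend ρ a (suc i) = ρ i

eval : ∀ {U : Set} {n} → (Fin n → U) → Term U n → U
eval ρ (var i) = ρ i
eval ρ (par a) = a
eval ρ (fun m g ts) = g (λ i → eval ρ (ts i))

module Semantics (𝒜 : RealizabilityAlgebra) (𝓜 : GroundModel 𝒜) where
  open RealizabilityAlgebra 𝒜
  open GroundModel 𝓜

  FV : Set₁
  FV = Π → Set

  infix 4 _⊩_
  _⊩_ : Λ → FV → Set
  ξ ⊩ X = ∀ π → X π → ⊥⊥ (ξ ⋆ π)

  ‖⊤‖ ‖⊥‖ : FV
  ‖⊤‖ _ = ⊥
  ‖⊥‖ _ = ⊤

  infixr 5 _⟶_
  _⟶_ : FV → FV → FV
  (X ⟶ Y) ρ = Σ Λ λ ξ → Σ Π λ π → (ρ ≡ ξ ∙ π) × (ξ ⊩ X) × Y π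

  ⋀ : (U → FV) → FV
  ⋀ P π = Σ U λ a → P a π

  -- ‖t = u ↪ F‖ : ‖F‖ if t = u holds in the ground model, ∅ otherwise
  hook : {A : Set} → A → A → FV → FV
  hook t u X π = (t ≡ u) × X π

  ‖_∉ε_‖ : U → U → FV
  ‖ a ∉ε b ‖ π = In a π b

  mutual
    subAcc : (a b : U) → Acc _≺_ a → Acc _≺_ b → FV
    subAcc a b (acc ra) ab ρ =
      Σ U λ c → Σ Λ λ ξ → Σ Π λ π → Σ (In c π a) λ m →
        (ρ ≡ ξ ∙ π) × (ξ ⊩ ninAcc c b (ra (π , m)) ab)

    ninAcc : (a b : U) → Acc _≺_ a → Acc _≺_ b → FV
    ninAcc a b aa (acc rb) ρ =
      Σ U λ c → Σ Λ λ ξ → Σ Λ λ ξ' → Σ Π λ π → Σ (In c π b) λ m →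
        (ρ ≡ ξ ∙ ξ' ∙ π)
        × (ξ ⊩ subAcc a c aa (rb (π , m)))
        × (ξ' ⊩ subAcc c a (rb (π , m)) aa)

  ‖_⊂_‖ : U → U → FV
  ‖ a ⊂ b ‖ = subAcc a b (≺-wf a) (≺-wf b)

  ‖_∉_‖ : U → U → FV
  ‖ a ∉ b ‖ = ninAcc a b (≺-wf a) (≺-wf b)

  ⟦_⟧ : ∀ {n} → Formula U n → (Fin n → U) → FV
  ⟦ ⊤' ⟧ ρ = ‖⊤‖
  ⟦ ⊥' ⟧ ρ = ‖⊥‖
  ⟦ t ∉ε u ⟧ ρ = ‖ eval ρ t ∉ε eval ρ u ‖
  ⟦ t ∉' u ⟧ ρ = ‖ eval ρ t ∉ eval ρ u ‖
  ⟦ t ⊂' u ⟧ ρ = ‖ eval ρ t ⊂ eval ρ u ‖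
  ⟦ A ⇒ B ⟧ ρ = ⟦ A ⟧ ρ ⟶ ⟦ B ⟧ ρ
  ⟦ ∀' A ⟧ ρ = ⋀ λ a → ⟦ A ⟧ (extend ρ a)

  infix 10 _[_]
  _[_] : Formula U 1 → U → FV
  F [ a ] = ⟦ F ⟧ (λ _ → a)

  -- A = λaλf (f)(a)af, as the combinator (W)(B)(BW)(C)B = W (B (B W (C B)))
  A : Λ
  A = W ＠ (B ＠ (B ＠ W ＠ (C ＠ B)))

  Y : Λ
  Y = A ＠ A

-- Y is a fixed point combinator at the level of execution:
-- Y ⋆ ξ · π ≻ ξ ⋆ (Y)ξ · π.  Let ξ realize the induction hypothesis
-- ∀y (∀x (x R y ↪ P x) → P y).  If (Y)ξ realizes P x for every
-- R-predecessor x of y, then it realizes the guarded quantifier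
-- ∀x (x R y ↪ P x), so ξ ⋆ (Y)ξ · π ∈ ⊥⊥ for every π ∈ ‖P y‖, and by
-- anti-execution Y ⋆ ξ · π ∈ ⊥⊥ as well ('fixpoint-step').  Well-founded
-- induction in the ground model then shows that (Y)ξ realizes every P y,
-- and one more fixpoint step yields that Y realizes the whole scheme.
-- Everything is proved for an arbitrary well-founded relation R and an
-- arbitrary family of falsity values P; the theorem is the instance
-- R x y = (f x y ≡ true) and P = F[_].
module Submission where

open import Defs
open import Data.Bool using (Bool; true)
open import Data.Product using (_×_; _,_)
open import Relation.Binary.PropositionalEquality using (_≡_; refl; subst; sym)
open import Induction.WellFounded using (WellFounded; Acc; acc)

module WellFoundedInduction (𝒜 : RealizabilityAlgebra) (𝓜 : GroundModel 𝒜) where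
  open RealizabilityAlgebra 𝒜
  open GroundModel 𝓜
  open Semantics 𝒜 𝓜

  infixr 3 _▸_
  _▸_ : ∀ {p q r} → p ≻ q → q ≻ r → p ≻ r
  _▸_ = ≻-trans

  Y-unfolds : ∀ ξ π → Y ⋆ ξ ∙ π ≻ ξ ⋆ (Y ＠ ξ) ∙ π
  Y-unfolds ξ π = ≻-app ▸ ≻-app ▸ ≻-W ▸ ≻-app ▸ ≻-B ▸ ≻-app ▸ ≻-app ▸ ≻-B
                ▸ ≻-W ▸ ≻-app ▸ ≻-app ▸ ≻-C ▸ ≻-B

  -- The falsity value of the guarded quantifier ∀x (x R y ↪ P x).
  guarded : (R : U → U → Set) → (U → FV) → U → FV
  guarded R P y = ⋀ λ x π → R x y × P x π

  Progressive : (R : U → U → Set) → (U → FV) → FV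
  Progressive R P = ⋀ λ y → guarded R P y ⟶ P y

  guarded-intro : ∀ {R P y} η → (∀ x → R x y → η ⊩ P x) → η ⊩ guarded R P y
  guarded-intro η ih π (x , xRy , π∈Px) = ih x xRy π π∈Px

  fixpoint-step : ∀ {R P} ξ → ξ ⊩ Progressive R P → ∀ y →
    (∀ x → R x y → (Y ＠ ξ) ⊩ P x) → ∀ π → P y π → ⊥⊥ (Y ⋆ ξ ∙ π)
  fixpoint-step {R} {P} ξ prog y ih π π∈Py =
    ⊥⊥-antiexec (Y-unfolds ξ π)
      (prog _ (y , Y ＠ ξ , π , refl , guarded-intro {R} {P} {y} (Y ＠ ξ) ih , π∈Py))

  Yξ-realizes : ∀ {R P} ξ → ξ ⊩ Progressive R P →
    ∀ y → Acc R y → (Y ＠ ξ) ⊩ P y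
  Yξ-realizes ξ prog y (acc rs) π π∈Py =
    ⊥⊥-antiexec ≻-app
      (fixpoint-step ξ prog y (λ x xRy → Yξ-realizes ξ prog x (rs xRy)) π π∈Py)

  Y-realizes-induction : ∀ {R P} → WellFounded R →
    Y ⊩ (Progressive R P ⟶ (⋀ λ y → P y))
  Y-realizes-induction wf ρ (ξ , π , ρ≡ξ∙π , prog , (y , π∈Py)) =
    subst (λ σ → ⊥⊥ (Y ⋆ σ)) (sym ρ≡ξ∙π)
      (fixpoint-step ξ prog y (λ x _ → Yξ-realizes ξ prog x (wf x)) π π∈Py)

theorem11 : (𝒜 : RealizabilityAlgebra) (𝓜 : GroundModel 𝒜) →
    let open Semantics 𝒜 𝓜 in
    (f : GroundModel.U 𝓜 → GroundModel.U 𝓜 → Bool) → WellFounded (λ x y → f x y ≡ true) →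
    (F : Formula (GroundModel.U 𝓜) 1) →
    Y ⊩ ((⋀ λ y → (⋀ λ x → hook (f x y) true (F [ x ])) ⟶ F [ y ]) ⟶ (⋀ λ y → F [ y ]))
theorem11 𝒜 𝓜 f wf F = Y-realizes-induction wf
  where open WellFoundedInduction 𝒜 𝓜
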